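{- Let $R$ be a left-reduced ground rewrite system contained in $\succ$, and let $\succ\!\!\succ_R$ be the non-Horn $R$-normalization closure ordering. Let $\iota$ be a ground Equality Resolution inference. Then the conclusion $\mathrm{concl}(\iota)$ of $\iota$ is $\succ\!\!\succ_R$-smaller than its premise.
   Context: $\succ$ is a reduction ordering on terms, total on ground terms. Clauses are finite multisets of literals $s\approx t$, $s\not\approx t$ ($\approx$ symmetric). $\succ_L$ maps $s\approx t$ to $\{s,t\}$ and $s\not\approx t$ to $\{s,s,t,t\}$, compared via the multiset extension of $\succ$; $\succ_C$ is the multiset extension of $\succ_L$; $L$ is maximal in $C\lor L$ if no literal of $C$ is larger. Most general unifiers are idempotent. A ground closure $(C\cdot\theta)$: clause $C$ and substitution $\theta$, $C\theta$ ground; identified up to bijective renaming of $C$ when instances coincide. $R$ contained in $\succ$: $u\succ v$ for all rules; left-reduced: no left-hand side reducible by the other rules; $t{\downarrow}_R$ normal form. Ground Equality Resolution: from $(C'\lor s\not\approx s'\cdot\theta)$ derive $(C'\sigma\cdot\theta)$, where $s\theta=s'\theta$, $\sigma=\mathrm{mgu}(s\doteq s')$, and $(s\not\approx s')\theta$ is maximal in $(C'\lor s\not\approx s')\theta$. Non-Horn ordering: $\mathrm{ss}^-(C)$ set of all subterms (including top) of sides of negative literals of $C$; $\mathrm{ts}^-(C)$ set of sides of negative literals. $\mathrm{rm}_R(t)=\emptyset$ if $t$ is $R$-irreducible, $\mathrm{rm}_R(t)=\{\{u,u\}\}\cup\mathrm{rm}_R(t')$ if $t\to_Rt'$ using $u\to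 v\in R$. $\mathrm{nm}_R(C\cdot\theta)=\bigcup_{f(t_1,\dots,t_n)\in\mathrm{ss}^-(C)}\mathrm{rm}_R(f(t_1\theta{\downarrow}_R,\dots,t_n\theta{\downarrow}_R))\cup\bigcup_{x\in\mathrm{ss}^-(C),x\text{ variable}}\mathrm{rm}_R(x\theta)\cup\bigcup_{t\in\mathrm{ts}^-(C)}\{\{t\theta{\downarrow}_R,t\theta{\downarrow}_R\}\}\cup\bigcup_{(s\approx s')\in C}\{\{s\theta,s'\theta\}\}$ (multiset unions; last union over positive literals of $C$). Fix a well-founded $\succ_{Clo}$ on ground closures, total on closures with equal ground instance, with $(C\cdot\theta_1)\succ_{Clo}(D\cdot\theta_2)$ whenever $C\theta_1=D\theta_2$ and $D$ is an instance of $C$ but not vice versa. $\succ\!\!\succ_R$: lexicographic combination of (1) $(\succ_{mul})_{mul}$ on $\mathrm{nm}_R$, (2) $\succ_C$ on ground instances, (3) $\succ_{Clo}$. -}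

module Defs where

open import Data.List using (List; []; _∷_; _++_; map; concat)
open import Data.List.Membership.Propositional using (_∈_)
open import Data.List.Relation.Unary.All using (All)
open import Data.List.Relation.Unary.Any using (Any)
import Data.List.Relation.Unary.Unique.Propositional as UniqueP
open import Data.List.Relation.Binary.Pointwise using (Pointwise)
open import Data.List.Relation.Binary.Permutation.Homogeneous using (Permutation)
open import Data.Product using (Σ; ∃; _×_; _,_; proj₁; proj₂)
open import Data.Sum using (_⊎_)
open import Function using (_∘_; flip)
open import Relation.Binary.Core using (Rel)
open import Level using (0ℓ)
open import Relation.Binary.PropositionalEquality using (_≡_; _≢_)
open import Relation.Binary.Construct.Closure.ReflexiveTransitive using (Star)
open import Relation.Nullary using (¬_)
open import Induction.WellFounded using (WellFounded)

-- Terms over function symbols F and variables V.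
-- (Arguments are lists; arity of symbols is not enforced.)

data Term (F V : Set) : Set where
  var : V → Term F V
  fun : F → List (Term F V) → Term F V

module _ {F V : Set} where

  Subst : Set
  Subst = V → Term F V

  mutual
    _⟪_⟫ : Term F V → Subst → Term F V
    var x ⟪ θ ⟫ = θ x
    fun f ts ⟪ θ ⟫ = fun f (ts ⟪ θ ⟫*)

    _⟪_⟫* : List (Term F V) → Subst → List (Term F V)
    [] ⟪ θ ⟫* = []
    (t ∷ ts) ⟪ θ ⟫* = (t ⟪ θ ⟫) ∷ (ts ⟪ θ ⟫*)

  _∘ₛ_ : Subst → Subst → Subst
  (σ ∘ₛ ρ) x = σ x ⟪ ρ ⟫

  data _⊴_ : Term F V → Term F V → Set where
    here : ∀ {t} → t ⊴ t
    arg  : ∀ {s t f ts} → s ⊴ t → t ∈ ts → s ⊴ fun f ts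

  Ground : Term F V → Set
  Ground t = ∀ x → ¬ (var x ⊴ t)

  data Step (u v : Term F V) : Term F V → Term F V → Set where
    top : Step u v u v
    arg : ∀ f pre {t t'} post → Step u v t t' →
          Step u v (fun f (pre ++ t ∷ post)) (fun f (pre ++ t' ∷ post))

  record ReductionOrdering (_≻_ : Rel (Term F V) 0ℓ) : Set where
    field
      irrefl     : ∀ t → ¬ (t ≻ t)
      trans      : ∀ {s t u} → s ≻ t → t ≻ u → s ≻ u
      wf         : WellFounded (flip _≻_)
      ctx        : ∀ f pre {s t} post → s ≻ t →
                   fun f (pre ++ s ∷ post) ≻ fun f (pre ++ t ∷ post)
      stable     : ∀ {s t} (θ : Subst) → s ≻ t → (s ⟪ θ ⟫) ≻ (t ⟪ θ ⟫)
      totalGround : ∀ s t → Ground s → Ground t → s ≡ t ⊎ s ≻ t ⊎ t ≻ s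

  RS : Set₁
  RS = Term F V → Term F V → Set

  GroundRS : RS → Set
  GroundRS R = ∀ u v → R u v → Ground u × Ground v

  ContainedIn : Rel (Term F V) 0ℓ → RS → Set
  ContainedIn _≻_ R = ∀ u v → R u v → u ≻ v

  LeftReduced : RS → Set
  LeftReduced R = ∀ u v u' v' → R u v → R u' v' → (u' , v') ≢ (u , v) →
                  ∀ w → ¬ Step u' v' u w

  _⟶[_]_ : Term F V → RS → Term F V → Set
  t ⟶[ R ] t' = Σ (Term F V) λ u → Σ (Term F V) λ v → R u v × Step u v t t'

  Irreducible : RS → Term F V → Set
  Irreducible R t = ∀ t' → ¬ (t ⟶[ R ] t')

  NF : RS → Term F V → Term F V → Set
  NF R t n = Star (λ a b → a ⟶[ R ] b) t n × Irreducible R n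

  -- Finite multisets as lists, compared up to permutation.

  MulExt : {A : Set} → Rel A 0ℓ → Rel A 0ℓ → Rel (List A) 0ℓ
  MulExt {A} _≈_ _>_ M N =
    Σ (List A) λ Z → Σ (List A) λ X → Σ (List A) λ Y →
      X ≢ [] × Permutation _≈_ M (Z ++ X) × Permutation _≈_ N (Z ++ Y) ×
      All (λ y → Any (λ x → x > y) X) Y

  MEq : Rel (List (Term F V)) _
  MEq = Permutation _≡_

  data Lit : Set where
    _≈ₗ_ : Term F V → Term F V → Lit
    _≉ₗ_ : Term F V → Term F V → Lit

  _⟪_⟫ₗ : Lit → Subst → Lit
  (s ≈ₗ t) ⟪ θ ⟫ₗ = (s ⟪ θ ⟫) ≈ₗ (t ⟪ θ ⟫)
  (s ≉ₗ t) ⟪ θ ⟫ₗ = (s ⟪ θ ⟫) ≉ₗ (t ⟪ θ ⟫)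

  -- ≈ is symmetric: literals are identified up to orientation
  data LitEq : Lit → Lit → Set where
    pos  : ∀ {s t} → LitEq (s ≈ₗ t) (s ≈ₗ t)
    posˢ : ∀ {s t} → LitEq (s ≈ₗ t) (t ≈ₗ s)
    neg  : ∀ {s t} → LitEq (s ≉ₗ t) (s ≉ₗ t)
    negˢ : ∀ {s t} → LitEq (s ≉ₗ t) (t ≉ₗ s)

  mL : Lit → List (Term F V)
  mL (s ≈ₗ t) = s ∷ t ∷ []
  mL (s ≉ₗ t) = s ∷ s ∷ t ∷ t ∷ []

  Clause : Set
  Clause = List Lit

  _⟪_⟫c : Clause → Subst → Clause
  C ⟪ θ ⟫c = map (_⟪ θ ⟫ₗ) C

  GroundLit : Lit → Set
  GroundLit L = All Ground (mL L)

  GroundClause : Clause → Set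
  GroundClause C = All GroundLit C

  ClauseEq : Rel Clause 0ℓ
  ClauseEq = Permutation LitEq

  module Orders (_≻_ : Rel (Term F V) 0ℓ) where

    _≻L_ : Rel Lit 0ℓ
    L ≻L L' = MulExt _≡_ _≻_ (mL L) (mL L')

    _≻C_ : Rel Clause 0ℓ
    _≻C_ = MulExt LitEq _≻L_

    MaximalIn : Lit → Clause → Set
    MaximalIn L C = All (λ K → ¬ (K ≻L L)) C

  Unifier : Subst → Term F V → Term F V → Set
  Unifier σ s s' = (s ⟪ σ ⟫) ≡ (s' ⟪ σ ⟫)

  IsMGU : Subst → Term F V → Term F V → Set
  IsMGU σ s s' = Unifier σ s s' ×
    (∀ τ → Unifier τ s s' → Σ Subst λ ρ → ∀ x → τ x ≡ (σ ∘ₛ ρ) x)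

  Idempotent : Subst → Set
  Idempotent σ = ∀ x → (σ ∘ₛ σ) x ≡ σ x

  Closure : Set
  Closure = Clause × Subst

  inst : Closure → Clause
  inst (C , θ) = C ⟪ θ ⟫c

  GroundClosure : Closure → Set
  GroundClosure c = GroundClause (inst c)

  InstanceOf : Clause → Clause → Set
  InstanceOf D C = Σ Subst λ ρ → ClauseEq D (C ⟪ ρ ⟫c)

  RenEq : Closure → Closure → Set
  RenEq (C , θ₁) (D , θ₂) =
    Σ (V → V) λ ρ → Σ (V → V) λ ρ⁻ →
      (∀ x → ρ⁻ (ρ x) ≡ x) × (∀ x → ρ (ρ⁻ x) ≡ x) ×
      ClauseEq D (C ⟪ var ∘ ρ ⟫c) × ClauseEq (C ⟪ θ₁ ⟫c) (D ⟪ θ₂ ⟫c)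

  record ClosureOrdering (_≻Clo_ : Rel Closure 0ℓ) : Set where
    field
      wf    : WellFounded (flip _≻Clo_)
      trans : ∀ {a b c} → a ≻Clo b → b ≻Clo c → a ≻Clo c
      total : ∀ c₁ c₂ → GroundClosure c₁ → GroundClosure c₂ →
              ClauseEq (inst c₁) (inst c₂) →
              c₁ ≻Clo c₂ ⊎ c₂ ≻Clo c₁ ⊎ RenEq c₁ c₂
      instanceGt : ∀ C θ₁ D θ₂ → GroundClause (C ⟪ θ₁ ⟫c) →
              ClauseEq (C ⟪ θ₁ ⟫c) (D ⟪ θ₂ ⟫c) →
              InstanceOf D C → ¬ InstanceOf C D → (C , θ₁) ≻Clo (D , θ₂)

  data RM (R : RS) : Term F V → List (List (Term F V)) → Set where
    irr  : ∀ {t} → Irreducible R t → RM R t []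
    step : ∀ {t t' u v M} → R u v → Step u v t t' → RM R t' M →
           RM R t ((u ∷ u ∷ []) ∷ M)

  data RMsub (R : RS) (θ : Subst) : Term F V → List (List (Term F V)) → Set where
    var : ∀ {x M} → RM R (θ x) M → RMsub R θ (var x) M
    fun : ∀ {f ts ns M} → Pointwise (NF R) (ts ⟪ θ ⟫*) ns →
          RM R (fun f ns) M → RMsub R θ (fun f ts) M

  NegSub : Clause → Term F V → Set
  NegSub C s = Σ (Term F V) λ a → Σ (Term F V) λ b →
               (a ≉ₗ b) ∈ C × (s ⊴ a ⊎ s ⊴ b)

  NegSide : Clause → Term F V → Set
  NegSide C s = Σ (Term F V) λ a → Σ (Term F V) λ b →
                (a ≉ₗ b) ∈ C × (s ≡ a ⊎ s ≡ b)

  Enumerates : (Term F V → Set) → List (Term F V) → Set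
  Enumerates P S = UniqueP.Unique S × (∀ s → s ∈ S → P s) × (∀ s → P s → s ∈ S)

  posPart : Clause → Subst → List (List (Term F V))
  posPart [] θ = []
  posPart ((s ≈ₗ t) ∷ C) θ = ((s ⟪ θ ⟫) ∷ (t ⟪ θ ⟫) ∷ []) ∷ posPart C θ
  posPart ((s ≉ₗ t) ∷ C) θ = posPart C θ

  NM : RS → Closure → List (List (Term F V)) → Set
  NM R (C , θ) N =
    Σ (List (Term F V)) λ S → Σ (List (List (List (Term F V)))) λ Ms →
    Σ (List (Term F V)) λ T → Σ (List (Term F V)) λ ns →
      Enumerates (NegSub C) S × Pointwise (RMsub R θ) S Ms ×
      Enumerates (NegSide C) T × Pointwise (λ t n → NF R (t ⟪ θ ⟫) n) T ns ×
      N ≡ concat Ms ++ map (λ n → n ∷ n ∷ []) ns ++ posPart C θ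

  module NonHorn (_≻_ : Rel (Term F V) 0ℓ) (R : RS) (_≻Clo_ : Rel Closure 0ℓ) where
    open Orders _≻_

    _≻≻_ : Rel Closure 0ℓ
    c₁ ≻≻ c₂ = ∀ N₁ N₂ → NM R c₁ N₁ → NM R c₂ N₂ →
      MulExt MEq (MulExt _≡_ _≻_) N₁ N₂ ⊎
      (Permutation MEq N₁ N₂ ×
        (inst c₁ ≻C inst c₂ ⊎ (ClauseEq (inst c₁) (inst c₂) × c₁ ≻Clo c₂)))

  record GroundEqRes (_≻_ : Rel (Term F V) 0ℓ) (C' : Clause) (s s' : Term F V)
                     (θ σ : Subst) : Set where
    open Orders _≻_
    field
      ground   : GroundClosure ((s ≉ₗ s') ∷ C' , θ)
      unif     : (s ⟪ θ ⟫) ≡ (s' ⟪ θ ⟫)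
      mgu      : IsMGU σ s s'
      idem     : Idempotent σ
      maximal  : MaximalIn ((s ≉ₗ s') ⟪ θ ⟫ₗ) (C' ⟪ θ ⟫c)

  premise : Clause → Term F V → Term F V → Subst → Closure
  premise C' s s' θ = ((s ≉ₗ s') ∷ C' , θ)

  conclusion : Clause → Subst → Subst → Closure
  conclusion C' σ θ = (C' ⟪ σ ⟫c , θ)

{-# OPTIONS --safe #-}
module Submission where

-- Since θ unifies s and s' and σ is an idempotent mgu, σθ = θ: the conclusion's ground instance
-- is the premise's minus the literal (s ≉ s')θ, and the positive literals contribute the same
-- pairs to nm_R.  A negative subterm of C'σ is either tσ for a non-variable negative subterm t
-- of C', contributing rm_R(f(tθ↓)) exactly as t does, or a subterm of xσ for a variable x
-- occurring negatively in C'.  In a left-reduced ground system two steps out of one term are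
-- equal or at disjoint positions, so they commute; hence normal forms and the multiset of rules
-- used to normalize a term are unique, and rm_R(xθ) = rm_R((xσ)θ) splits into the contributions
-- of all subterm occurrences of xσ.  Negative sides of C'σ are instances tσ of those of C'.
-- Therefore nm_R of the conclusion is a sub-multiset of nm_R of the premise: either strictly
-- smaller, or equal, and then ≻_C decides because one literal was removed.

open import Defs
open import Algebra.Bundles using (CommutativeMonoid)
import Algebra.Properties.CommutativeSemigroup as CommutativeSemigroupProperties
open import Data.Empty using (⊥-elim)
open import Data.List using (List; []; _∷_; _++_; [_]; map; concat; concatMap)
open import Data.List.Properties
  using (++-assoc; ∷-injective; concat-++; map-id; map-∘; map-cong; concatMap-map; concatMap-pure)
open import Data.List.Membership.Propositional using (_∈_)
open import Data.List.Membership.Propositional.Properties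
  using (∈-map⁺; ∈-map⁻; ∈-concat⁺′; ∈-++⁺ˡ; ∈-++⁺ʳ)
open import Data.List.Relation.Binary.Pointwise as Pointwise using (Pointwise; []; _∷_)
open import Data.List.Relation.Binary.Subset.Propositional using (_⊆_)
import Data.List.Relation.Binary.Permutation.Homogeneous as Homogeneous
import Data.List.Relation.Binary.Permutation.Setoid as Permutation
import Data.List.Relation.Binary.Permutation.Setoid.Properties as PermutationProperties
open import Data.List.Relation.Unary.All as All using ([]; _∷_)
open import Data.List.Relation.Unary.AllPairs using ([]; _∷_)
open import Data.List.Relation.Unary.Any using (here; there)
open import Data.List.Relation.Unary.Unique.Propositional using (Unique)
open import Data.Nat using (ℕ; suc; _+_; _≤_; s≤s)
open import Data.Nat.Properties using (≤-refl; ≤-trans; m≤m+n; m≤n+m; n≤1+n; <⇒≢)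
open import Data.Product using (Σ; _×_; _,_; proj₁; proj₂)
open import Data.Sum using (inj₁; inj₂; _⊎_; map₂)
open import Function using (id; _∘_)
open import Level using (0ℓ)
open import Relation.Binary.Bundles using (Setoid)
open import Relation.Binary.Core using (Rel)
open import Relation.Binary.Construct.Closure.ReflexiveTransitive using (Star; ε; _◅_)
open import Relation.Binary.PropositionalEquality
  using (_≡_; _≢_; _≗_; refl; sym; trans; cong; cong₂; subst; subst₂; setoid; module ≡-Reasoning)

private variable
  F V : Set

mutual
  ⟪⟫-∘ₛ : (t : Term F V) (σ ρ : Subst) → (t ⟪ σ ⟫) ⟪ ρ ⟫ ≡ t ⟪ σ ∘ₛ ρ ⟫
  ⟪⟫-∘ₛ (var x)    σ ρ = refl
  ⟪⟫-∘ₛ (fun f ts) σ ρ = cong (fun f) (⟪⟫*-∘ₛ ts σ ρ)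

  ⟪⟫*-∘ₛ : (ts : List (Term F V)) (σ ρ : Subst) → (ts ⟪ σ ⟫*) ⟪ ρ ⟫* ≡ ts ⟪ σ ∘ₛ ρ ⟫*
  ⟪⟫*-∘ₛ []       σ ρ = refl
  ⟪⟫*-∘ₛ (t ∷ ts) σ ρ = cong₂ _∷_ (⟪⟫-∘ₛ t σ ρ) (⟪⟫*-∘ₛ ts σ ρ)

mutual
  ⟪⟫-cong : (t : Term F V) {σ τ : Subst} → σ ≗ τ → t ⟪ σ ⟫ ≡ t ⟪ τ ⟫
  ⟪⟫-cong (var x)    σ≗τ = σ≗τ x
  ⟪⟫-cong (fun f ts) σ≗τ = cong (fun f) (⟪⟫*-cong ts σ≗τ)

  ⟪⟫*-cong : (ts : List (Term F V)) {σ τ : Subst} → σ ≗ τ → ts ⟪ σ ⟫* ≡ ts ⟪ τ ⟫*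
  ⟪⟫*-cong []       σ≗τ = refl
  ⟪⟫*-cong (t ∷ ts) σ≗τ = cong₂ _∷_ (⟪⟫-cong t σ≗τ) (⟪⟫*-cong ts σ≗τ)

idempotent-mgu-∘ₛ : {σ θ : Subst} {s s' : Term F V} →
                    IsMGU σ s s' → Idempotent σ → Unifier θ s s' → σ ∘ₛ θ ≗ θ
idempotent-mgu-∘ₛ {σ = σ} {θ} (_ , most-general) idem unif x
  with ρ , θ≗σρ ← most-general θ unif = begin
  σ x ⟪ θ ⟫          ≡⟨ ⟪⟫-cong (σ x) θ≗σρ ⟩
  σ x ⟪ σ ∘ₛ ρ ⟫     ≡⟨ ⟪⟫-∘ₛ (σ x) σ ρ ⟨
  (σ x ⟪ σ ⟫) ⟪ ρ ⟫  ≡⟨ cong (_⟪ ρ ⟫) (idem x) ⟩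
  σ x ⟪ ρ ⟫          ≡⟨ θ≗σρ x ⟨
  θ x                ∎
  where open ≡-Reasoning

module _ {F V : Set} {σ θ : Subst {F} {V}} (σθ≗θ : σ ∘ₛ θ ≗ θ) where

  ⟪⟫-absorb : (t : Term F V) → (t ⟪ σ ⟫) ⟪ θ ⟫ ≡ t ⟪ θ ⟫
  ⟪⟫-absorb t = trans (⟪⟫-∘ₛ t σ θ) (⟪⟫-cong t σθ≗θ)

  ⟪⟫*-absorb : (ts : List (Term F V)) → (ts ⟪ σ ⟫*) ⟪ θ ⟫* ≡ ts ⟪ θ ⟫*
  ⟪⟫*-absorb ts = trans (⟪⟫*-∘ₛ ts σ θ) (⟪⟫*-cong ts σθ≗θ)

  ⟪⟫ₗ-absorb : (L : Lit) → (L ⟪ σ ⟫ₗ) ⟪ θ ⟫ₗ ≡ L ⟪ θ ⟫ₗ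
  ⟪⟫ₗ-absorb (a ≈ₗ b) = cong₂ _≈ₗ_ (⟪⟫-absorb a) (⟪⟫-absorb b)
  ⟪⟫ₗ-absorb (a ≉ₗ b) = cong₂ _≉ₗ_ (⟪⟫-absorb a) (⟪⟫-absorb b)

  ⟪⟫c-absorb : (C : Clause) → (C ⟪ σ ⟫c) ⟪ θ ⟫c ≡ C ⟪ θ ⟫c
  ⟪⟫c-absorb C = trans (sym (map-∘ C)) (map-cong ⟪⟫ₗ-absorb C)

  posPart-absorb : (C : Clause) → posPart (C ⟪ σ ⟫c) θ ≡ posPart C θ
  posPart-absorb []             = refl
  posPart-absorb ((a ≈ₗ b) ∷ C) =
    cong₂ _∷_ (cong₂ (λ x y → x ∷ y ∷ []) (⟪⟫-absorb a) (⟪⟫-absorb b)) (posPart-absorb C)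
  posPart-absorb ((a ≉ₗ b) ∷ C) = posPart-absorb C

mutual
  size : Term F V → ℕ
  size (var x)    = 1
  size (fun f ts) = suc (sizes ts)

  sizes : List (Term F V) → ℕ
  sizes []       = 0
  sizes (t ∷ ts) = size t + sizes ts

size≤sizes : ∀ pre (a : Term F V) post → size a ≤ sizes (pre ++ a ∷ post)
size≤sizes []        a post = m≤m+n (size a) (sizes post)
size≤sizes (b ∷ pre) a post = ≤-trans (size≤sizes pre a post) (m≤n+m _ (size b))

Step⇒lhs-size≤ : ∀ {u v t t' : Term F V} → Step u v t t' → size u ≤ size t
Step⇒lhs-size≤ top                = ≤-refl
Step⇒lhs-size≤ (arg f pre post s) =
  ≤-trans (Step⇒lhs-size≤ s) (≤-trans (size≤sizes pre _ post) (n≤1+n _))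

Step⇒lhs≢context : ∀ {u v a a' : Term F V} f pre post → Step u v a a' → u ≢ fun f (pre ++ a ∷ post)
Step⇒lhs≢context f pre post s u≡t =
  <⇒≢ (s≤s (≤-trans (Step⇒lhs-size≤ s) (size≤sizes pre _ post))) (cong size u≡t)

fun-injective : ∀ {f g} {ts us : List (Term F V)} → fun f ts ≡ fun g us → f ≡ g × ts ≡ us
fun-injective refl = refl , refl

data Positions {A : Set} : List A → A → List A → List A → A → List A → Set where
  equal  : ∀ {p a q} → Positions p a q p a q
  before : ∀ {p a m b q} → Positions p a (m ++ b ∷ q) (p ++ a ∷ m) b q
  after  : ∀ {p a m b q} → Positions (p ++ a ∷ m) b q p a (m ++ b ∷ q)

comparePositions : ∀ {A : Set} p₁ (a₁ : A) q₁ p₂ a₂ q₂ →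
                   p₁ ++ a₁ ∷ q₁ ≡ p₂ ++ a₂ ∷ q₂ → Positions p₁ a₁ q₁ p₂ a₂ q₂
comparePositions []       a₁ q₁ []       a₂ q₂ refl = equal
comparePositions []       a₁ q₁ (b ∷ p₂) a₂ q₂ refl = before {p = []}
comparePositions (b ∷ p₁) a₁ q₁ []       a₂ q₂ refl = after {p = []}
comparePositions (b ∷ p₁) a₁ q₁ (c ∷ p₂) a₂ q₂ eq with refl , eq' ← ∷-injective eq
  with comparePositions p₁ a₁ q₁ p₂ a₂ q₂ eq'
... | equal  = equal
... | before = before
... | after  = after

fun-reassoc : ∀ f p (a : Term F V) m b q → fun f ((p ++ a ∷ m) ++ b ∷ q) ≡ fun f (p ++ a ∷ m ++ b ∷ q)
fun-reassoc f p a m b q = cong (Term.fun f) (++-assoc p (a ∷ m) (b ∷ q))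

Step-in-first : ∀ {u v a a' : Term F V} f p m b q →
  Step u v a a' → Step u v (fun f ((p ++ a ∷ m) ++ b ∷ q)) (fun f (p ++ a' ∷ m ++ b ∷ q))
Step-in-first {u = u} {v} {a} {a'} f p m b q s =
  subst (λ t → Step u v t (fun f (p ++ a' ∷ m ++ b ∷ q))) (sym (fun-reassoc f p a m b q))
        (arg f p (m ++ b ∷ q) s)

Step-in-second : ∀ {u v b b' : Term F V} f p a m q →
  Step u v b b' → Step u v (fun f (p ++ a ∷ m ++ b ∷ q)) (fun f (p ++ a ∷ m ++ b' ∷ q))
Step-in-second {b = b} {b'} f p a m q s =
  subst₂ (Step _ _) (fun-reassoc f p a m b q) (fun-reassoc f p a m b' q) (arg f (p ++ a ∷ m) q s)

mutual
  subterms : Term F V → List (Term F V)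
  subterms (var x)    = var x ∷ []
  subterms (fun f ts) = fun f ts ∷ subterms* ts

  subterms* : List (Term F V) → List (Term F V)
  subterms* []       = []
  subterms* (t ∷ ts) = subterms t ++ subterms* ts

mutual
  ⊴⇒∈subterms : ∀ {u t : Term F V} → u ⊴ t → u ∈ subterms t
  ⊴⇒∈subterms {t = var x}    here = here refl
  ⊴⇒∈subterms {t = fun f ts} here = here refl
  ⊴⇒∈subterms (arg u⊴t t∈ts)      = there (⊴⇒∈subterms* u⊴t t∈ts)

  ⊴⇒∈subterms* : ∀ {u t : Term F V} {ts} → u ⊴ t → t ∈ ts → u ∈ subterms* ts
  ⊴⇒∈subterms* {ts = t ∷ ts} u⊴t (here refl) = ∈-++⁺ˡ (⊴⇒∈subterms u⊴t)
  ⊴⇒∈subterms* {ts = t ∷ ts} u⊴t (there t∈ts) = ∈-++⁺ʳ (subterms t) (⊴⇒∈subterms* u⊴t t∈ts)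

-- The members of ss⁻(Cσ) accounted for by a member t of ss⁻(C).
instSubterms : Subst → Term F V → List (Term F V)
instSubterms σ (var x)    = subterms (σ x)
instSubterms σ (fun f ts) = fun f ts ⟪ σ ⟫ ∷ []

mutual
  ⊴-⟪⟫ : ∀ {u} (t : Term F V) σ → u ⊴ (t ⟪ σ ⟫) → Σ (Term F V) λ t' → t' ⊴ t × u ∈ instSubterms σ t'
  ⊴-⟪⟫ (var x)    σ u⊴σx = var x , here , ⊴⇒∈subterms u⊴σx
  ⊴-⟪⟫ (fun f ts) σ here = fun f ts , here , here refl
  ⊴-⟪⟫ (fun f ts) σ (arg u⊴t t∈tsσ) with t₀ , t₀∈ts , t' , t'⊴t₀ , u∈ ← ⊴-⟪⟫* ts σ u⊴t t∈tsσ =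
    t' , arg t'⊴t₀ t₀∈ts , u∈

  ⊴-⟪⟫* : ∀ {u t} (ts : List (Term F V)) σ → u ⊴ t → t ∈ ts ⟪ σ ⟫* →
          Σ (Term F V) λ t₀ → t₀ ∈ ts × Σ (Term F V) λ t' → t' ⊴ t₀ × u ∈ instSubterms σ t'
  ⊴-⟪⟫* (t ∷ ts) σ u⊴tσ (here refl) = t , here refl , ⊴-⟪⟫ t σ u⊴tσ
  ⊴-⟪⟫* (t ∷ ts) σ u⊴t (there t∈tsσ) with t₀ , t₀∈ts , rest ← ⊴-⟪⟫* ts σ u⊴t t∈tsσ =
    t₀ , there t₀∈ts , rest

≉∈⟪⟫c : ∀ {a b : Term F V} C σ → (a ≉ₗ b) ∈ C ⟪ σ ⟫c →
        Σ (Term F V) λ a' → Σ (Term F V) λ b' → (a' ≉ₗ b') ∈ C × a ≡ a' ⟪ σ ⟫ × b ≡ b' ⟪ σ ⟫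
≉∈⟪⟫c C σ ≉∈Cσ with ∈-map⁻ (_⟪ σ ⟫ₗ) ≉∈Cσ
... | a' ≉ₗ b' , ≉∈C , refl = a' , b' , ≉∈C , refl , refl
... | a' ≈ₗ b' , _ , ()

NegSub-⟪⟫ : ∀ {u : Term F V} C σ → NegSub (C ⟪ σ ⟫c) u →
            Σ (Term F V) λ t → NegSub C t × u ∈ instSubterms σ t
NegSub-⟪⟫ C σ (_ , _ , ≉∈Cσ , u⊴side) with a' , b' , ≉∈C , refl , refl ← ≉∈⟪⟫c C σ ≉∈Cσ
  with u⊴side
... | inj₁ u⊴a = let t , t⊴a' , u∈ = ⊴-⟪⟫ a' σ u⊴a in t , (a' , b' , ≉∈C , inj₁ t⊴a') , u∈
... | inj₂ u⊴b = let t , t⊴b' , u∈ = ⊴-⟪⟫ b' σ u⊴b in t , (a' , b' , ≉∈C , inj₂ t⊴b') , u∈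

NegSide-⟪⟫ : ∀ {u : Term F V} C σ → NegSide (C ⟪ σ ⟫c) u → Σ (Term F V) λ t → NegSide C t × u ≡ t ⟪ σ ⟫
NegSide-⟪⟫ C σ (_ , _ , ≉∈Cσ , u≡side) with a' , b' , ≉∈C , refl , refl ← ≉∈⟪⟫c C σ ≉∈Cσ
  with u≡side
... | inj₁ refl = a' , (a' , b' , ≉∈C , inj₁ refl) , refl
... | inj₂ refl = b' , (a' , b' , ≉∈C , inj₂ refl) , refl

NegSub-∷ : ∀ {t : Term F V} {L C} → NegSub C t → NegSub (L ∷ C) t
NegSub-∷ (a , b , ≉∈C , t⊴side) = a , b , there ≉∈C , t⊴side

NegSide-∷ : ∀ {t : Term F V} {L C} → NegSide C t → NegSide (L ∷ C) t
NegSide-∷ (a , b , ≉∈C , t≡side) = a , b , there ≉∈C , t≡side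

LitEq-refl : (L : Lit {F} {V}) → LitEq L L
LitEq-refl (a ≈ₗ b) = pos
LitEq-refl (a ≉ₗ b) = neg

module _ {F V : Set} (_≻_ : Rel (Term F V) 0ℓ) where
  open Orders _≻_
  open PermutationProperties (setoid (Lit {F} {V})) using (∷↭∷ʳ; ++-identityʳ)
  open Permutation (setoid (Lit {F} {V})) using (↭-sym)

  ∷-≻C : (L : Lit) (C : Clause) → (L ∷ C) ≻C C
  ∷-≻C L C = C , L ∷ [] , [] , (λ ()) , ≡⇒LitEq (∷↭∷ʳ L C) , ≡⇒LitEq (↭-sym (++-identityʳ C)) , []
    where ≡⇒LitEq = Homogeneous.map λ { {L} refl → LitEq-refl L }

  premise-≻C-conclusion : ∀ {C s s'} {σ θ : Subst} → σ ∘ₛ θ ≗ θ →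
                          inst (premise C s s' θ) ≻C inst (conclusion C σ θ)
  premise-≻C-conclusion {C} {s} {s'} {σ} {θ} σθ≗θ =
    subst ((((s ≉ₗ s') ∷ C) ⟪ θ ⟫c) ≻C_) (sym (⟪⟫c-absorb σθ≗θ C)) (∷-≻C _ (C ⟪ θ ⟫c))

module SubMultiset (S : Setoid 0ℓ 0ℓ) where
  open Setoid S using (_≈_) renaming (Carrier to A)
  open Permutation S using (_↭_; ↭-refl; ↭-sym; ↭-trans; module PermutationReasoning)
  open PermutationProperties S using (++⁺; ++⁺ˡ; ++-identityʳ; shifts; ++-commutativeMonoid)
    renaming (++-assoc to ↭-++-assoc)
  open CommutativeSemigroupProperties (CommutativeMonoid.commutativeSemigroup ++-commutativeMonoid)
    using (interchange)

  infix 4 _⊑_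
  _⊑_ : Rel (List A) 0ℓ
  M ⊑ N = Σ (List A) λ X → N ↭ M ++ X

  ↭⇒⊑ : ∀ {M N} → N ↭ M → M ⊑ N
  ↭⇒⊑ {M} N↭M = [] , ↭-trans N↭M (↭-sym (++-identityʳ M))

  ⊑-respʳ-↭ : ∀ {M N N'} → N ↭ N' → M ⊑ N' → M ⊑ N
  ⊑-respʳ-↭ N↭N' (X , N'↭MX) = X , ↭-trans N↭N' N'↭MX

  ⊑-++ : ∀ {M₁ N₁ M₂ N₂} → M₁ ⊑ N₁ → M₂ ⊑ N₂ → M₁ ++ M₂ ⊑ N₁ ++ N₂
  ⊑-++ {M₁} {_} {M₂} (X₁ , p₁) (X₂ , p₂) = X₁ ++ X₂ , ↭-trans (++⁺ p₁ p₂) (interchange M₁ X₁ M₂ X₂)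

  -- MulExt takes the parameters F and V of its defining module without using them.
  ⊑⇒MulExt⊎↭ : ∀ (_>_ : Rel A 0ℓ) {M N} → M ⊑ N → MulExt {F} {V} _≈_ _>_ N M ⊎ N ↭ M
  ⊑⇒MulExt⊎↭ _ {M} ([]    , N↭M) = inj₂ (↭-trans N↭M (++-identityʳ M))
  ⊑⇒MulExt⊎↭ _ {M} (x ∷ X , N↭MX) = inj₁ (M , x ∷ X , [] , (λ ()) , N↭MX , ↭-sym (++-identityʳ M) , [])

  module _ {K B : Set} {P : K → B → Set} (chunk : B → List A)
           (chunk-unique : ∀ {k b b'} → P k b → P k b' → chunk b ↭ chunk b') where

    Pointwise-remove : ∀ {k ks bs} → k ∈ ks → Pointwise P ks bs →
      Σ B λ b → Σ (List K) λ ks' → Σ (List B) λ bs' →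
        P k b × Pointwise P ks' bs' × concatMap chunk bs ↭ chunk b ++ concatMap chunk bs' ×
        (∀ {k'} → k' ∈ ks → k' ≢ k → k' ∈ ks')
    Pointwise-remove (here refl) (_∷_ {y = b} p ps) =
      b , _ , _ , p , ps , ↭-refl , λ { (here refl) k≢k → ⊥-elim (k≢k refl) ; (there k'∈ks) _ → k'∈ks }
    Pointwise-remove (there k∈ks) (_∷_ {y = b₀} p₀ ps) with Pointwise-remove k∈ks ps
    ... | b , ks' , bs' , p , ps' , bs↭ , keep =
      b , _ ∷ ks' , b₀ ∷ bs' , p , p₀ ∷ ps' ,
      ↭-trans (++⁺ˡ (chunk b₀) bs↭) (shifts (chunk b₀) (chunk b)) ,
      λ { (here refl) _ → here refl ; (there k'∈ks) k'≢k → there (keep k'∈ks k'≢k) }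

    chunks-⊑ : ∀ {ks₁ bs₁ ks₂ bs₂} → Unique ks₂ → ks₂ ⊆ ks₁ →
               Pointwise P ks₁ bs₁ → Pointwise P ks₂ bs₂ → concatMap chunk bs₂ ⊑ concatMap chunk bs₁
    chunks-⊑ {bs₁ = bs₁} [] _ _ [] = concatMap chunk bs₁ , ↭-refl
    chunks-⊑ {bs₁ = bs₁} (k∉ks₂ ∷ unique) ks₂⊆ks₁ ps₁ (_∷_ {y = b₂} {ys = bs₂} p₂ ps₂)
      with b , _ , bs₁' , p , ps₁' , bs₁↭ , keep ← Pointwise-remove (ks₂⊆ks₁ (here refl)) ps₁
      with X , bs₁'↭ ← chunks-⊑ unique
                         (λ k'∈ks₂ → keep (ks₂⊆ks₁ (there k'∈ks₂)) (λ { refl → All.lookup k∉ks₂ k'∈ks₂ refl }))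
                         ps₁' ps₂
      = X , (begin
        concatMap chunk bs₁                     ↭⟨ bs₁↭ ⟩
        chunk b ++ concatMap chunk bs₁'         ↭⟨ ++⁺ (chunk-unique p p₂) bs₁'↭ ⟩
        chunk b₂ ++ concatMap chunk bs₂ ++ X    ↭⟨ ↭-++-assoc (chunk b₂) _ X ⟨
        (chunk b₂ ++ concatMap chunk bs₂) ++ X  ∎)
      where open PermutationReasoning

MEq-setoid : (F V : Set) → Setoid 0ℓ 0ℓ
MEq-setoid F V = Homogeneous.setoid {R = _≡_ {A = Term F V}} refl sym

module LeftReducedGround {F V : Set} {_≻_ : Rel (Term F V) 0ℓ} (ro : ReductionOrdering _≻_)
                         {R : RS {F} {V}} (ground : GroundRS R) (left-reduced : LeftReduced R) where
  open ReductionOrdering ro using (irrefl; totalGround)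
  open Permutation (MEq-setoid F V) using (_↭_; ↭-refl; ↭-sym; ↭-trans; ↭-reflexive; ↭-prep; ↭-swap)
  open PermutationProperties (MEq-setoid F V) using (++⁺; ++⁺ˡ; ++-identityʳ; shifts; ↭-shift)

  private
    Bag = List (List (Term F V))

  -- v₁ ≢ v₂ cannot be refuted without decidable equality; totality of ≻ on ground terms
  -- provides the case split.
  rule-functional : ∀ {u v₁ v₂} → R u v₁ → R u v₂ → v₁ ≡ v₂
  rule-functional {u} {v₁} {v₂} r₁ r₂
    with totalGround v₁ v₂ (proj₂ (ground u v₁ r₁)) (proj₂ (ground u v₂ r₂))
  ... | inj₁ v₁≡v₂        = v₁≡v₂
  ... | inj₂ (inj₁ v₁≻v₂) =
    ⊥-elim (left-reduced u v₁ u v₂ r₁ r₂ (λ eq → irrefl v₁ (subst (v₁ ≻_) (cong proj₂ eq) v₁≻v₂)) v₂ top)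
  ... | inj₂ (inj₂ v₂≻v₁) =
    ⊥-elim (left-reduced u v₂ u v₁ r₂ r₁ (λ eq → irrefl v₂ (subst (v₂ ≻_) (cong proj₂ eq) v₂≻v₁)) v₁ top)

  lhs-args-irreducible : ∀ {v} f pre {w} post → R (fun f (pre ++ w ∷ post)) v → Irreducible R w
  lhs-args-irreducible f pre post r w' (u' , v' , r' , s') =
    left-reduced _ _ u' v' r r' (λ eq → Step⇒lhs≢context f pre post s' (cong proj₁ eq)) _ (arg f pre post s')

  arg-irreducible : ∀ f pre {w} post → Irreducible R (fun f (pre ++ w ∷ post)) → Irreducible R w
  arg-irreducible f pre post irr-t w' (u , v , r , s) = irr-t _ (u , v , r , arg f pre post s)

  data Diamond (u₁ v₁ u₂ v₂ t₁ t₂ : Term F V) : Set where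
    same    : u₁ ≡ u₂ → t₁ ≡ t₂ → Diamond u₁ v₁ u₂ v₂ t₁ t₂
    commute : ∀ {t₃} → Step u₂ v₂ t₁ t₃ → Step u₁ v₁ t₂ t₃ → Diamond u₁ v₁ u₂ v₂ t₁ t₂

  private
    diamond-≡ : ∀ {u₁ v₁ u₂ v₂ t t' t₁ t₂} → R u₁ v₁ → R u₂ v₂ →
                Step u₁ v₁ t t₁ → Step u₂ v₂ t' t₂ → t ≡ t' → Diamond u₁ v₁ u₂ v₂ t₁ t₂
    diamond-≡ r₁ r₂ top top refl = same refl (rule-functional r₁ r₂)
    diamond-≡ r₁ r₂ top (arg f p q s₂) refl = ⊥-elim (lhs-args-irreducible f p q r₁ _ (_ , _ , r₂ , s₂))
    diamond-≡ r₁ r₂ (arg f p q s₁) top refl = ⊥-elim (lhs-args-irreducible f p q r₂ _ (_ , _ , r₁ , s₁))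
    diamond-≡ r₁ r₂ (arg f p₁ q₁ s₁) (arg g p₂ q₂ s₂) eq with fun-injective eq
    ... | refl , args≡ with comparePositions p₁ _ q₁ p₂ _ q₂ args≡
    ... | equal with diamond-≡ r₁ r₂ s₁ s₂ refl
    ...   | same u₁≡u₂ refl = same u₁≡u₂ refl
    ...   | commute s₁' s₂' = commute (arg f p₁ q₁ s₁') (arg f p₁ q₁ s₂')
    diamond-≡ r₁ r₂ (arg f p q₁ s₁) (arg g _ q s₂) eq | refl , _ | before {m = m} =
      commute (Step-in-second f p _ m q s₂) (Step-in-first f p m _ q s₁)
    diamond-≡ r₁ r₂ (arg f _ q s₁) (arg g p q₂ s₂) eq | refl , _ | after {m = m} =
      commute (Step-in-first f p m _ q s₂) (Step-in-second f p _ m q s₁)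

  diamond : ∀ {u₁ v₁ u₂ v₂ t t₁ t₂} → R u₁ v₁ → R u₂ v₂ →
            Step u₁ v₁ t t₁ → Step u₂ v₂ t t₂ → Diamond u₁ v₁ u₂ v₂ t₁ t₂
  diamond r₁ r₂ s₁ s₂ = diamond-≡ r₁ r₂ s₁ s₂ refl

  NF-step : ∀ {t t' n} → Irreducible R n → Star (λ a b → a ⟶[ R ] b) t n → t ⟶[ R ] t' →
            Star (λ a b → a ⟶[ R ] b) t' n
  NF-step irr-n ε s = ⊥-elim (irr-n _ s)
  NF-step irr-n ((u₁ , v₁ , r₁ , s₁) ◅ steps) (u , v , r , s) with diamond r₁ r s₁ s
  ... | same refl refl = steps
  ... | commute s₁' s' = (u₁ , v₁ , r₁ , s') ◅ NF-step irr-n steps (u , v , r , s₁')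

  NF-unique : ∀ {t n₁ n₂} → NF R t n₁ → NF R t n₂ → n₁ ≡ n₂
  NF-unique (ε , _)     (ε , _)     = refl
  NF-unique (ε , irr-n) (s ◅ _ , _) = ⊥-elim (irr-n _ s)
  NF-unique (s ◅ steps , irr-n) (steps₂ , irr-n₂) =
    NF-unique (steps , irr-n) (NF-step irr-n₂ steps₂ s , irr-n₂)

  NFs-unique : ∀ {ts ns₁ ns₂} → Pointwise (NF R) ts ns₁ → Pointwise (NF R) ts ns₂ → ns₁ ≡ ns₂
  NFs-unique []           []           = refl
  NFs-unique (nf₁ ∷ nfs₁) (nf₂ ∷ nfs₂) = cong₂ _∷_ (NF-unique nf₁ nf₂) (NFs-unique nfs₁ nfs₂)

  RM-step : ∀ {t t' u v M} → RM R t M → R u v → Step u v t t' →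
            Σ Bag λ M' → RM R t' M' × M ↭ (u ∷ u ∷ []) ∷ M'
  RM-step (irr irr-t) r s = ⊥-elim (irr-t _ (_ , _ , r , s))
  RM-step (step {M = M} r₁ s₁ rest) r s with diamond r₁ r s₁ s
  ... | same refl refl  = M , rest , ↭-refl
  ... | commute s₁' s' with RM-step rest r s₁'
  ...   | M' , rest' , M↭ = _ , step r₁ s' rest' , ↭-trans (↭-prep _ M↭) (↭-swap _ _ ↭-refl)

  RM-unique : ∀ {t M₁ M₂} → RM R t M₁ → RM R t M₂ → M₁ ↭ M₂
  RM-unique (irr _)         (irr _)         = ↭-refl
  RM-unique (irr irr-t)     (step r s _)    = ⊥-elim (irr-t _ (_ , _ , r , s))
  RM-unique (step r s _)    (irr irr-t)     = ⊥-elim (irr-t _ (_ , _ , r , s))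
  RM-unique (step r s rest) rm₂@(step _ _ _) with RM-step rm₂ r s
  ... | M₂' , rest₂ , M₂↭ = ↭-trans (↭-prep _ (RM-unique rest rest₂)) (↭-sym M₂↭)

  RMsub-unique : ∀ {θ t M₁ M₂} → RMsub R θ t M₁ → RMsub R θ t M₂ → M₁ ↭ M₂
  RMsub-unique (var rm₁)      (var rm₂) = RM-unique rm₁ rm₂
  RMsub-unique (fun nfs₁ rm₁) (fun nfs₂ rm₂) with refl ← NFs-unique nfs₁ nfs₂ = RM-unique rm₁ rm₂

  RM-arg : ∀ f pre w post {t M} → RM R t M → t ≡ fun f (pre ++ w ∷ post) →
    Σ (Term F V) λ n → Σ Bag λ Mw → Σ Bag λ M' →
      NF R w n × RM R w Mw × RM R (fun f (pre ++ n ∷ post)) M' × M ↭ Mw ++ M'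
  RM-arg f pre w post (irr irr-t) refl =
    let irr-w = arg-irreducible f pre post irr-t
    in  w , [] , [] , (ε , irr-w) , irr irr-w , irr irr-t , ↭-refl
  RM-arg f pre w post (step r top rest) refl =
    let irr-w = lhs-args-irreducible f pre post r
    in  w , [] , _ , (ε , irr-w) , irr irr-w , step r top rest , ↭-refl
  RM-arg f pre w post (step r (arg g p {a} {a'} q s) rest) eq with fun-injective eq
  ... | refl , args≡ with comparePositions p a q pre w post args≡
  ... | equal with RM-arg f pre a' post rest refl
  ...   | n , Mw , M' , (steps , irr-n) , rm-w , rm' , M↭ =
    n , _ ∷ Mw , M' , ((_ , _ , r , s) ◅ steps , irr-n) , step r s rm-w , rm' , ↭-prep _ M↭
  RM-arg f pre w post (step r (arg g p {a} {a'} q s) rest) eq | refl , _ | before {m = m}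
    with RM-arg f (p ++ a' ∷ m) w post rest (sym (fun-reassoc f p a' m w post))
  ... | n , Mw , M' , nf , rm-w , rm' , M↭ =
    n , Mw , _ ∷ M' , nf , rm-w ,
    step r (Step-in-first f p m n post s) (subst (λ t → RM R t M') (fun-reassoc f p a' m n post) rm') ,
    ↭-trans (↭-prep _ M↭) (↭-sym (↭-shift Mw M'))
  RM-arg f pre w post (step r (arg g p {a} {a'} q s) rest) eq | refl , _ | after {m = m}
    with RM-arg f pre w (m ++ a' ∷ q) rest (fun-reassoc f pre w m a' q)
  ... | n , Mw , M' , nf , rm-w , rm' , M↭ =
    n , Mw , _ ∷ M' , nf , rm-w , step r (Step-in-second f pre n m q s) rm' ,
    ↭-trans (↭-prep _ M↭) (↭-sym (↭-shift Mw M'))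

  RM-args : ∀ f pre (ws : List (Term F V)) {M} → RM R (fun f (pre ++ ws)) M →
    Σ (List (Term F V)) λ ns → Σ (List Bag) λ Mws → Σ Bag λ M' →
      Pointwise (NF R) ws ns × Pointwise (RM R) ws Mws × RM R (fun f (pre ++ ns)) M' × M ↭ M' ++ concat Mws
  RM-args f pre [] {M} rm = [] , [] , M , [] , [] , rm , ↭-sym (++-identityʳ M)
  RM-args f pre (w ∷ ws) rm with RM-arg f pre w ws rm refl
  ... | n , Mw , M₁ , nf , rm-w , rm₁ , M↭
    with RM-args f (pre ++ n ∷ []) ws (subst (λ xs → RM R (fun f xs) M₁) (sym (++-assoc pre [ n ] ws)) rm₁)
  ... | ns , Mws , M' , nfs , rm-ws , rm' , M₁↭ =
    n ∷ ns , Mw ∷ Mws , M' , nf ∷ nfs , rm-w ∷ rm-ws ,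
    subst (λ xs → RM R (fun f xs) M') (++-assoc pre [ n ] ns) rm' ,
    ↭-trans M↭ (↭-trans (++⁺ˡ Mw M₁↭) (shifts Mw M'))

  mutual
    RM-subterms : ∀ θ (t : Term F V) {M} → RM R (t ⟪ θ ⟫) M →
      Σ (List Bag) λ Ms → Pointwise (RMsub R θ) (subterms t) Ms × M ↭ concat Ms
    RM-subterms θ (var x) {M} rm = [ M ] , var rm ∷ [] , ↭-sym (++-identityʳ M)
    RM-subterms θ (fun f ts) rm with RM-args f [] (ts ⟪ θ ⟫*) rm
    ... | _ , _ , M' , nfs , rms , rm' , M↭ with RM-subterms* θ ts rms
    ...   | Ms , rmsubs , Mss↭ = M' ∷ Ms , fun nfs rm' ∷ rmsubs , ↭-trans M↭ (++⁺ˡ M' Mss↭)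

    RM-subterms* : ∀ θ (ts : List (Term F V)) {Mss} → Pointwise (RM R) (ts ⟪ θ ⟫*) Mss →
      Σ (List Bag) λ Ms → Pointwise (RMsub R θ) (subterms* ts) Ms × concat Mss ↭ concat Ms
    RM-subterms* θ []       []         = [] , [] , ↭-refl
    RM-subterms* θ (t ∷ ts) (rm ∷ rms) with RM-subterms θ t rm | RM-subterms* θ ts rms
    ... | Ms₁ , rmsubs₁ , M↭ | Ms₂ , rmsubs₂ , Mss↭ =
      Ms₁ ++ Ms₂ , Pointwise.++⁺ rmsubs₁ rmsubs₂ , ↭-trans (++⁺ M↭ Mss↭) (↭-reflexive (concat-++ Ms₁ Ms₂))

module InstanceMeasure {F V : Set} {_≻_ : Rel (Term F V) 0ℓ} (ro : ReductionOrdering _≻_)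
                       {R : RS {F} {V}} (ground : GroundRS R) (left-reduced : LeftReduced R)
                       {σ θ : Subst {F} {V}} (σθ≗θ : σ ∘ₛ θ ≗ θ) where
  open LeftReducedGround ro ground left-reduced
  open SubMultiset (MEq-setoid F V)
  open Permutation (MEq-setoid F V) using (_↭_; ↭-refl; ↭-sym; ↭-trans; ↭-reflexive)
  open PermutationProperties (MEq-setoid F V) using (++⁺; ++-identityʳ)

  private
    Bag = List (List (Term F V))

    NF-θ : Term F V → Term F V → Set
    NF-θ t n = NF R (t ⟪ θ ⟫) n

    double : Term F V → List (Term F V)
    double n = n ∷ n ∷ []

  RMsub-instSubterms : ∀ {t M} → RMsub R θ t M →
    Σ (List Bag) λ Ms → Pointwise (RMsub R θ) (instSubterms σ t) Ms × M ↭ concat Ms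
  RMsub-instSubterms {var x} (var rm) = RM-subterms θ (σ x) (subst (λ t → RM R t _) (sym (σθ≗θ x)) rm)
  RMsub-instSubterms {fun f ts} {M} (fun {ns = ns} nfs rm) =
    [ M ] , fun (subst (λ us → Pointwise (NF R) us ns) (sym (⟪⟫*-absorb σθ≗θ ts)) nfs) rm ∷ [] ,
    ↭-sym (++-identityʳ M)

  RMsubs-instSubterms : ∀ {S Ms} → Pointwise (RMsub R θ) S Ms →
    Σ (List Bag) λ Ms' → Pointwise (RMsub R θ) (concatMap (instSubterms σ) S) Ms' × concat Ms ↭ concat Ms'
  RMsubs-instSubterms [] = [] , [] , ↭-refl
  RMsubs-instSubterms (rm ∷ rms) with RMsub-instSubterms rm | RMsubs-instSubterms rms
  ... | Ms₁ , rmsubs₁ , M↭ | Ms₂ , rmsubs₂ , Ms↭ =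
    Ms₁ ++ Ms₂ , Pointwise.++⁺ rmsubs₁ rmsubs₂ , ↭-trans (++⁺ M↭ Ms↭) (↭-reflexive (concat-++ Ms₁ Ms₂))

  negSubterms-⊑ : ∀ {C S₁ Ms₁ S₂ Ms₂} → (∀ t → NegSub C t → t ∈ S₁) → Pointwise (RMsub R θ) S₁ Ms₁ →
    Enumerates (NegSub (C ⟪ σ ⟫c)) S₂ → Pointwise (RMsub R θ) S₂ Ms₂ → concat Ms₂ ⊑ concat Ms₁
  negSubterms-⊑ {C} {S₁} {_} {S₂} {Ms₂} S₁-complete rms₁ (S₂-unique , S₂-sound , _) rms₂ =
    let Ms₁' , rms₁' , Ms₁↭ = RMsubs-instSubterms rms₁ in
    ⊑-respʳ-↭ Ms₁↭ (subst₂ _⊑_ (concat-map-id Ms₂) (concat-map-id Ms₁')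
                               (chunks-⊑ id RMsub-unique S₂-unique covered rms₁' rms₂))
    where
      concat-map-id : (Ms : List Bag) → concatMap id Ms ≡ concat Ms
      concat-map-id Ms = cong concat (map-id Ms)

      covered : S₂ ⊆ concatMap (instSubterms σ) S₁
      covered {u} u∈S₂ with t , t∈ss⁻ , u∈ ← NegSub-⟪⟫ C σ (S₂-sound u u∈S₂) =
        ∈-concat⁺′ u∈ (∈-map⁺ (instSubterms σ) (S₁-complete t t∈ss⁻))

  negSides-⊑ : ∀ {C T₁ ns₁ T₂ ns₂} → (∀ t → NegSide C t → t ∈ T₁) → Pointwise NF-θ T₁ ns₁ →
    Enumerates (NegSide (C ⟪ σ ⟫c)) T₂ → Pointwise NF-θ T₂ ns₂ → map double ns₂ ⊑ map double ns₁
  negSides-⊑ {C} {T₁} {ns₁} {T₂} {ns₂} T₁-complete nfs₁ (T₂-unique , T₂-sound , _) nfs₂ =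
    subst₂ _⊑_ (concatMap-double ns₂) (concatMap-double ns₁)
      (chunks-⊑ ([_] ∘ double) (λ nf nf' → ↭-reflexive (cong ([_] ∘ double) (NF-unique nf nf')))
                T₂-unique covered (NFs-⟪⟫ nfs₁) nfs₂)
    where
      concatMap-double : ∀ ns → concatMap ([_] ∘ double) ns ≡ map double ns
      concatMap-double ns = trans (sym (concatMap-map [_] double ns)) (concatMap-pure (map double ns))

      NFs-⟪⟫ : ∀ {ts ns} → Pointwise NF-θ ts ns → Pointwise NF-θ (map (_⟪ σ ⟫) ts) ns
      NFs-⟪⟫ []                     = []
      NFs-⟪⟫ (_∷_ {x = t} nf nfs) = subst (λ u → NF R u _) (sym (⟪⟫-absorb σθ≗θ t)) nf ∷ NFs-⟪⟫ nfs

      covered : T₂ ⊆ map (_⟪ σ ⟫) T₁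
      covered {u} u∈T₂ with t , t∈ts⁻ , refl ← NegSide-⟪⟫ C σ (T₂-sound u u∈T₂) =
        ∈-map⁺ (_⟪ σ ⟫) (T₁-complete t t∈ts⁻)

  nm-conclusion-⊑-premise : ∀ {C s s' N₁ N₂} →
    NM R (premise C s s' θ) N₁ → NM R (conclusion C σ θ) N₂ → N₂ ⊑ N₁
  nm-conclusion-⊑-premise {C}
    (_ , _ , _ , _ , (_ , _ , S₁-complete) , rms₁ , (_ , _ , T₁-complete) , nfs₁ , refl)
    (_ , _ , _ , _ , S₂-enumerates , rms₂ , T₂-enumerates , nfs₂ , refl) =
    ⊑-++ (negSubterms-⊑ (λ t → S₁-complete t ∘ NegSub-∷) rms₁ S₂-enumerates rms₂)
         (⊑-++ (negSides-⊑ (λ t → T₁-complete t ∘ NegSide-∷) nfs₁ T₂-enumerates nfs₂)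
               (↭⇒⊑ (↭-reflexive (sym (posPart-absorb σθ≗θ C)))))

lemma14 : {F V : Set} (_≻_ : Rel (Term F V) 0ℓ) → ReductionOrdering _≻_ →
          (R : RS) → GroundRS R → LeftReduced R → ContainedIn _≻_ R →
          (_≻Clo_ : Rel Closure 0ℓ) → ClosureOrdering _≻Clo_ →
          ∀ (C' : Clause) (s s' : Term F V) (θ σ : Subst) →
          GroundEqRes _≻_ C' s s' θ σ →
          NonHorn._≻≻_ _≻_ R _≻Clo_ (premise C' s s' θ) (conclusion C' σ θ)
lemma14 {F} {V} _≻_ ro R ground left-reduced _ _ _ C' s s' θ σ ger _ _ nm₁ nm₂ =
  map₂ (_, inj₁ (premise-≻C-conclusion _≻_ {C'} {s} {s'} σθ≗θ))
       (⊑⇒MulExt⊎↭ {F} {V} (MulExt {F} {V} _≡_ _≻_) (nm-conclusion-⊑-premise nm₁ nm₂))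
  where
    open GroundEqRes ger using (unif; mgu; idem)
    σθ≗θ : σ ∘ₛ θ ≗ θ
    σθ≗θ = idempotent-mgu-∘ₛ {s = s} {s'} mgu idem unif
    open InstanceMeasure ro ground left-reduced {σ} {θ} σθ≗θ
    open SubMultiset (MEq-setoid F V) using (⊑⇒MulExt⊎↭)
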